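{- Let $\mathbf{a}$ be a weak $m$-part composition of $n\ge1$ and let $t=(k,l)$ with $0\le k\le n$ and $1\le l\le m$. Suppose the point $(k+1,l)$ is dominated by $\mathbf{a}^{j}$ for all $j$. Then each of the sets $B_0,\ldots,B_{n-1}$ is complete with respect to $t$.
   Context: $\mathbf{a}=(a_0,\ldots,a_{m-1})$ is a tuple of nonnegative integers summing to $n$; indices are read mod $m$. Let $f_{\mathbf{a}}(y)=a_r(y-r)+\sum_{j=0}^{r-1}a_j$ for $y\in[r,r+1]$, $0\le r<m$. A lattice point $(x,y)$ with $0\le y\le m$ is dominated by $\mathbf{a}$ if $x\ge f_{\mathbf{a}}(y)$. Cyclic shifts: $\mathbf{a}^{j}=(a_{ -j},\ldots,a_{ -j+m-1})$. For a lattice point $p=(x,y)$ with $0\le x<n$, $1\le y\le m$ and integer $r\ge0$, $S^{r}(p)=(x+a_{ -1}+\cdots+a_{ -r}\bmod n,\ y+r\bmod m)$ with residues in $\{0,\ldots,n-1\}$ and $\{1,\ldots,m\}$. For $0\le i<n$ let $y_i$ be the least integer with $i<f_{\mathbf{a}}(y_i)$, $p_i=(i,y_i)$, $s_i=m+1-y_i$, $b_i^r=S^{s_i+r}(p_i)$ for $0\le r<m$, and $B_i=\{b_i^0,\ldots,b_i^{m-1}\}$. $B_i$ is complete with respect to $t=(k,l)$ if the $x$-coordinate of $b_i^{l-1}$ is at most $k$. -}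

module Defs where

open import Data.Nat as ℕ using (ℕ; zero; suc; _+_; _∸_; _≤_; _<_; _<?_; NonZero)
open import Data.Nat.DivMod using (_%_)
open import Data.Integer as ℤ using (ℤ; +_)
open import Data.Integer.DivMod using (_%ℕ_; n%ℕd<d)
open import Data.Fin using (Fin; toℕ; fromℕ<)
open import Data.Product using (_×_; _,_; proj₁)
open import Relation.Nullary using (yes; no)

Tuple : ℕ → Set
Tuple m = Fin m → ℕ

at : ∀ {m} .{{_ : NonZero m}} → Tuple m → ℤ → ℕ
at {m} a i = a (fromℕ< (n%ℕd<d i m))

prefix : ∀ {m} .{{_ : NonZero m}} → Tuple m → ℕ → ℕ
prefix a zero    = 0
prefix a (suc y) = prefix a y + at a (+ y)

total : ∀ {m} .{{_ : NonZero m}} → Tuple m → ℕ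
total {m} a = prefix a m

IsWeakComposition : ∀ {m} .{{_ : NonZero m}} → Tuple m → ℕ → Set
IsWeakComposition a n = total a ≡′ n
  where open import Relation.Binary.PropositionalEquality renaming (_≡_ to _≡′_)

-- f_a at an integer height y ∈ {0,…,m}: f_a(y) = a_0 + … + a_{y-1}
-- (the piecewise-linear formula with r = y, or r = y-1, gives this value).
f : ∀ {m} .{{_ : NonZero m}} → Tuple m → ℕ → ℕ
f a y = prefix a y

Dominated : ∀ {m} .{{_ : NonZero m}} → Tuple m → ℕ × ℕ → Set
Dominated a (x , y) = f a y ≤ x

shift : ∀ {m} .{{_ : NonZero m}} → Tuple m → ℤ → Tuple m
shift a j i = at a (+ toℕ i ℤ.- j)

negSum : ∀ {m} .{{_ : NonZero m}} → Tuple m → ℕ → ℕ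
negSum a zero    = 0
negSum a (suc r) = negSum a r + at a (ℤ.- (+ suc r))

-- S^r(p) for p = (x,y), residues in {0,…,n-1} and {1,…,m}
S : ∀ {m} .{{_ : NonZero m}} (n : ℕ) .{{_ : NonZero n}} →
    Tuple m → ℕ → ℕ × ℕ → ℕ × ℕ
S {m} n a r (x , y) = ((x + negSum a r) % n , suc ((y + r ∸ 1) % m))

search : ∀ {m} .{{_ : NonZero m}} → Tuple m → ℕ → ℕ → ℕ → ℕ
search a i zero       y = y
search a i (suc fuel) y with i <? f a y
... | yes _ = y
... | no  _ = search a i fuel (suc y)

-- y_i : the least integer with i < f_a(y_i)  (for 0 ≤ i < n it lies in {1,…,m})
yIdx : ∀ {m} .{{_ : NonZero m}} → Tuple m → ℕ → ℕ
yIdx {m} a i = search a i (suc m) 0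

pt : ∀ {m} .{{_ : NonZero m}} → Tuple m → ℕ → ℕ × ℕ
pt a i = (i , yIdx a i)

sIdx : ∀ {m} .{{_ : NonZero m}} → Tuple m → ℕ → ℕ
sIdx {m} a i = suc m ∸ yIdx a i

b : ∀ {m} .{{_ : NonZero m}} (n : ℕ) .{{_ : NonZero n}} →
    Tuple m → ℕ → ℕ → ℕ × ℕ
b n a i r = S n a (sIdx a i + r) (pt a i)

Complete : ∀ {m} .{{_ : NonZero m}} (n : ℕ) .{{_ : NonZero n}} →
           Tuple m → ℕ → ℕ × ℕ → Set
Complete n a i (k , l) = proj₁ (b n a i (l ∸ 1)) ≤ k

module Submission where

-- Fix 0 ≤ i < n and write y_i = y + 1, so that f(y) ≤ i < f(y+1) and y < m.
-- With l = l' + 1 the x-coordinate of b_i^{l-1} is (i + σ) mod n, where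
-- σ = a_{-1} + … + a_{-r} and r = s_i + l - 1 = (m - y) + l'.  Now σ + f(y+1) is the sum of
-- the r + y + 1 = m + l consecutive entries a_{-r}, …, a_y; splitting off one full period
-- gives σ + f(y+1) = n + W, where W = a_{y-l+1} + … + a_y is the window of length l ending
-- at a_y.  Every window of length l equals f_{a^j}(l) for a suitable shift j, so the
-- domination hypothesis gives W ≤ k + 1.  Hence i + σ = n + e with e = W + i - f(y+1),
-- and 0 ≤ e ≤ k because a_y ≤ W and i < f(y+1); so (i + σ) mod n = e mod n ≤ k.

open import Defs
open import Data.Nat using (ℕ; suc; _≤_; _<_; NonZero)
open import Data.Integer using (ℤ)
open import Data.Product using (Σ; _×_; _,_)
open import Data.Nat as ℕ using (zero; z≤n; s≤s; s≤s⁻¹; _+_; _∸_; _%_; pred)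
open import Data.Nat.Properties as ℕₚ
  using (<-cmp; ≤-refl; <⇒≤; ≮⇒≥; m≤n⇒m<n∨m≡n; +-comm; +-assoc; +-suc;
         +-identityʳ; +-cancelˡ-≡; +-cancelʳ-≡; +-cancelʳ-≤; +-monoˡ-≤; +-monoʳ-≤;
         m≤n+m; m∸n+n≡m; +-∸-assoc; ∸-monoʳ-<; <⇒≱)
open import Data.Nat.DivMod using ([m+n]%n≡m%n; n%n≡0; m<n⇒m%n≡m; m%n≤m; m≡m%n+[m/n]*n)
open import Data.Integer as ℤ using (+_; -[1+_]; _⊖_; _%ℕ_)
import Data.Integer.Properties as ℤₚ
open import Data.Integer.DivMod using (n%ℕd<d)
open import Data.Fin.Properties using (fromℕ<-cong; toℕ-fromℕ<)
open import Data.Sum using (inj₁; inj₂)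
open import Data.Empty using (⊥-elim)
open import Relation.Binary.Definitions using (tri<; tri≈; tri>)
open import Relation.Binary.PropositionalEquality
  using (_≡_; refl; sym; trans; cong; cong₂; subst; module ≡-Reasoning)
open import Relation.Nullary using (yes; no)
import Data.Integer.Tactic.RingSolver as ℤ-Ring
import Data.Nat.Tactic.RingSolver as ℕ-Ring

negRemainder : ℕ → ℕ → ℕ
negRemainder d zero    = 0
negRemainder d (suc r) = d ∸ suc r

neg-%ℕ : ∀ p d .{{_ : NonZero d}} → -[1+ p ] %ℕ d ≡ negRemainder d (suc p % d)
neg-%ℕ p d with suc p % d
... | zero  = refl
... | suc r = refl

%ℕ-periodic : ∀ z d .{{_ : NonZero d}} → (z ℤ.+ + d) %ℕ d ≡ z %ℕ d
%ℕ-periodic (+ p)    d = [m+n]%n≡m%n p d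
%ℕ-periodic -[1+ p ] d with <-cmp (suc p) d
... | tri< 1+p<d _ _ = begin
  (d ⊖ suc p) %ℕ d            ≡⟨ cong (_%ℕ d) (ℤₚ.⊖-≥ (<⇒≤ 1+p<d)) ⟩
  (d ∸ suc p) % d             ≡⟨ m<n⇒m%n≡m (∸-monoʳ-< (s≤s z≤n) (<⇒≤ 1+p<d)) ⟩
  d ∸ suc p                   ≡⟨ cong (negRemainder d) (sym (m<n⇒m%n≡m 1+p<d)) ⟩
  negRemainder d (suc p % d)  ≡⟨ sym (neg-%ℕ p d) ⟩
  -[1+ p ] %ℕ d               ∎
  where open ≡-Reasoning
... | tri≈ _ refl _ = begin
  (suc p ⊖ suc p) %ℕ suc p                  ≡⟨ cong (_%ℕ suc p) (ℤₚ.n⊖n≡0 (suc p)) ⟩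
  0                                         ≡⟨ cong (negRemainder (suc p)) (sym (n%n≡0 (suc p))) ⟩
  negRemainder (suc p) (suc p % suc p)      ≡⟨ sym (neg-%ℕ p (suc p)) ⟩
  -[1+ p ] %ℕ suc p                         ∎
  where open ≡-Reasoning
... | tri> _ _ d<1+p = begin
  (d ⊖ suc p) %ℕ d                  ≡⟨ cong (_%ℕ d) (ℤₚ.⊖-< d<1+p) ⟩
  (ℤ.- (+ (suc p ∸ d))) %ℕ d        ≡⟨ cong (λ x → (ℤ.- (+ x)) %ℕ d) (+-∸-assoc 1 d≤p) ⟩
  -[1+ p ∸ d ] %ℕ d                 ≡⟨ neg-%ℕ (p ∸ d) d ⟩
  negRemainder d (suc (p ∸ d) % d)  ≡⟨ cong (negRemainder d) same-remainder ⟩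
  negRemainder d (suc p % d)        ≡⟨ sym (neg-%ℕ p d) ⟩
  -[1+ p ] %ℕ d                     ∎
  where
  open ≡-Reasoning
  d≤p : d ≤ p
  d≤p = s≤s⁻¹ d<1+p
  same-remainder : suc (p ∸ d) % d ≡ suc p % d
  same-remainder = trans (sym ([m+n]%n≡m%n (suc (p ∸ d)) d))
                         (cong (λ x → suc x % d) (m∸n+n≡m d≤p))

-- The arithmetic core: if σ + P = n + W, P ≤ W + i, i < P and W ≤ k + 1,
-- then i + σ = n + (W + i - P) with W + i - P ≤ k, hence (i + σ) mod n ≤ k.
mod-bound : ∀ n .{{_ : NonZero n}} {i σ P W k} →
            σ + P ≡ n + W → P ≤ W + i → i < P → W ≤ suc k → (i + σ) % n ≤ k
mod-bound n {i} {σ} {P} {W} {k} σ+P≡n+W P≤W+i i<P W≤1+k = begin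
  (i + σ) % n   ≡⟨ cong (_% n) i+σ≡n+e ⟩
  (n + e) % n   ≡⟨ trans (cong (_% n) (+-comm n e)) ([m+n]%n≡m%n e n) ⟩
  e % n         ≤⟨ m%n≤m e n ⟩
  e             ≤⟨ e≤k ⟩
  k             ∎
  where
  open ℕₚ.≤-Reasoning
  e = (W + i) ∸ P
  e+P≡W+i : e + P ≡ W + i
  e+P≡W+i = m∸n+n≡m P≤W+i
  i+σ≡n+e : i + σ ≡ n + e
  i+σ≡n+e = +-cancelʳ-≡ P _ _ (begin-equality
    (i + σ) + P    ≡⟨ +-assoc i σ P ⟩
    i + (σ + P)    ≡⟨ cong (_+_ i) σ+P≡n+W ⟩
    i + (n + W)    ≡⟨ rotate i n W ⟩
    n + (W + i)    ≡˘⟨ cong (_+_ n) e+P≡W+i ⟩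
    n + (e + P)    ≡˘⟨ +-assoc n e P ⟩
    (n + e) + P    ∎)
    where
    rotate : ∀ x y z → x + (y + z) ≡ y + (z + x)
    rotate = ℕ-Ring.solve-∀
  e≤k : e ≤ k
  e≤k = +-cancelʳ-≤ P e k (begin
    e + P          ≡⟨ e+P≡W+i ⟩
    W + i          ≤⟨ +-monoˡ-≤ i W≤1+k ⟩
    suc k + i      ≡⟨ sym (+-suc k i) ⟩
    k + suc i      ≤⟨ +-monoʳ-≤ k i<P ⟩
    k + P          ∎)

module _ {m : ℕ} .{{_ : NonZero m}} (a : Tuple m) where
  open ≡-Reasoning

  at-cong : ∀ z w → z %ℕ m ≡ w %ℕ m → at a z ≡ at a w
  at-cong z w eq = cong a (fromℕ<-cong _ _ eq (n%ℕd<d z m) (n%ℕd<d w m))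

  at-periodic : ∀ z → at a (z ℤ.+ + m) ≡ at a z
  at-periodic z = at-cong (z ℤ.+ + m) z (%ℕ-periodic z m)

  at-periodic* : ∀ z q → at a (z ℤ.+ + (q ℕ.* m)) ≡ at a z
  at-periodic* z zero    = cong (at a) (ℤₚ.+-identityʳ z)
  at-periodic* z (suc q) = begin
    at a (z ℤ.+ + (m + q ℕ.* m))          ≡⟨ cong (λ x → at a (z ℤ.+ x)) (ℤₚ.pos-+ m (q ℕ.* m)) ⟩
    at a (z ℤ.+ (+ m ℤ.+ + (q ℕ.* m)))    ≡⟨ cong (at a) (regroup z (+ m) (+ (q ℕ.* m))) ⟩
    at a ((z ℤ.+ + (q ℕ.* m)) ℤ.+ + m)    ≡⟨ at-periodic (z ℤ.+ + (q ℕ.* m)) ⟩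
    at a (z ℤ.+ + (q ℕ.* m))              ≡⟨ at-periodic* z q ⟩
    at a z                                ∎
    where
    regroup : ∀ (x y w : ℤ) → x ℤ.+ (y ℤ.+ w) ≡ (x ℤ.+ w) ℤ.+ y
    regroup = ℤ-Ring.solve-∀

  window : ℤ → ℕ → ℕ
  window lo zero      = 0
  window lo (suc len) = at a lo + window (lo ℤ.+ + 1) len

  window-cong : ∀ {lo lo′} len → lo ≡ lo′ → window lo len ≡ window lo′ len
  window-cong len = cong (λ lo → window lo len)

  window-++ : ∀ lo p q → window lo (p + q) ≡ window lo p + window (lo ℤ.+ + p) q
  window-++ lo zero    q = window-cong q (sym (ℤₚ.+-identityʳ lo))
  window-++ lo (suc p) q = begin
    at a lo + window (lo ℤ.+ + 1) (p + q)
      ≡⟨ cong (_+_ (at a lo)) (window-++ (lo ℤ.+ + 1) p q) ⟩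
    at a lo + (window (lo ℤ.+ + 1) p + window ((lo ℤ.+ + 1) ℤ.+ + p) q)
      ≡⟨ sym (+-assoc (at a lo) _ _) ⟩
    window lo (suc p) + window ((lo ℤ.+ + 1) ℤ.+ + p) q
      ≡⟨ cong (_+_ (window lo (suc p))) (window-cong q (ℤₚ.+-assoc lo (+ 1) (+ p))) ⟩
    window lo (suc p) + window (lo ℤ.+ + suc p) q
      ∎

  window-snoc : ∀ lo len → window lo (suc len) ≡ window lo len + at a (lo ℤ.+ + len)
  window-snoc lo len = begin
    window lo (suc len)                                 ≡⟨ cong (window lo) (+-comm 1 len) ⟩
    window lo (len + 1)                                 ≡⟨ window-++ lo len 1 ⟩
    window lo len + (at a (lo ℤ.+ + len) + 0)           ≡⟨ cong (_+_ (window lo len)) (+-identityʳ _) ⟩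
    window lo len + at a (lo ℤ.+ + len)                 ∎

  prefix≡window : ∀ y → prefix a y ≡ window (+ 0) y
  prefix≡window zero    = refl
  prefix≡window (suc y) = trans (cong (_+ at a (+ y)) (prefix≡window y)) (sym (window-snoc (+ 0) y))

  window-step : ∀ lo → window (lo ℤ.+ + 1) m ≡ window lo m
  window-step lo = +-cancelˡ-≡ (at a lo) _ _ (begin
    at a lo + window (lo ℤ.+ + 1) m    ≡⟨ window-snoc lo m ⟩
    window lo m + at a (lo ℤ.+ + m)    ≡⟨ cong (_+_ (window lo m)) (at-periodic lo) ⟩
    window lo m + at a lo              ≡⟨ +-comm (window lo m) (at a lo) ⟩
    at a lo + window lo m              ∎)

  window-translate : ∀ lo q → window (lo ℤ.+ + q) m ≡ window lo m
  window-translate lo zero    = window-cong m (ℤₚ.+-identityʳ lo)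
  window-translate lo (suc q) = begin
    window (lo ℤ.+ + suc q) m              ≡⟨ window-cong m one-more ⟩
    window ((lo ℤ.+ + q) ℤ.+ + 1) m        ≡⟨ window-step (lo ℤ.+ + q) ⟩
    window (lo ℤ.+ + q) m                  ≡⟨ window-translate lo q ⟩
    window lo m                            ∎
    where
    one-more : lo ℤ.+ + suc q ≡ (lo ℤ.+ + q) ℤ.+ + 1
    one-more = trans (cong (λ x → lo ℤ.+ + x) (+-comm 1 q)) (sym (ℤₚ.+-assoc lo (+ q) (+ 1)))

  window-period : ∀ lo → window lo m ≡ total a
  window-period (+ p)    = trans (window-translate (+ 0) p) (sym (prefix≡window m))
  window-period -[1+ p ] = begin
    window -[1+ p ] m                         ≡˘⟨ window-translate -[1+ p ] (suc p) ⟩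
    window (-[1+ p ] ℤ.+ + suc p) m           ≡⟨ window-cong m (ℤₚ.+-inverseˡ (+ suc p)) ⟩
    window (+ 0) m                            ≡˘⟨ prefix≡window m ⟩
    total a                                   ∎

  negSum≡window : ∀ r → negSum a r ≡ window (ℤ.- + r) r
  negSum≡window zero    = refl
  negSum≡window (suc r) = begin
    negSum a r + at a -[1+ r ]                       ≡⟨ +-comm (negSum a r) _ ⟩
    at a -[1+ r ] + negSum a r                       ≡⟨ cong (_+_ (at a -[1+ r ])) (negSum≡window r) ⟩
    at a -[1+ r ] + window (ℤ.- + r) r               ≡⟨ cong (_+_ (at a -[1+ r ])) (window-cong r (-[1+r]+1 r)) ⟩
    at a -[1+ r ] + window (-[1+ r ] ℤ.+ + 1) r      ∎
    where
    -[1+r]+1 : ∀ r → ℤ.- + r ≡ -[1+ r ] ℤ.+ + 1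
    -[1+r]+1 zero    = refl
    -[1+r]+1 (suc r) = refl

  shift-at : ∀ j l → at (shift a j) (+ l) ≡ at a (ℤ.- j ℤ.+ + l)
  shift-at j l = begin
    at (shift a j) (+ l)
      ≡⟨ cong (λ x → at a (+ x ℤ.- j)) (toℕ-fromℕ< (n%ℕd<d (+ l) m)) ⟩
    at a (+ (l % m) ℤ.- j)
      ≡˘⟨ at-periodic* (+ (l % m) ℤ.- j) (l ℕ./ m) ⟩
    at a ((+ (l % m) ℤ.- j) ℤ.+ + (l ℕ./ m ℕ.* m))
      ≡⟨ cong (at a) (regroup (+ (l % m)) j (+ (l ℕ./ m ℕ.* m))) ⟩
    at a (ℤ.- j ℤ.+ (+ (l % m) ℤ.+ + (l ℕ./ m ℕ.* m)))
      ≡˘⟨ cong (λ x → at a (ℤ.- j ℤ.+ x)) (ℤₚ.pos-+ (l % m) (l ℕ./ m ℕ.* m)) ⟩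
    at a (ℤ.- j ℤ.+ + (l % m + l ℕ./ m ℕ.* m))
      ≡˘⟨ cong (λ x → at a (ℤ.- j ℤ.+ + x)) (m≡m%n+[m/n]*n l m) ⟩
    at a (ℤ.- j ℤ.+ + l)
      ∎
    where
    regroup : ∀ (x j w : ℤ) → (x ℤ.- j) ℤ.+ w ≡ ℤ.- j ℤ.+ (x ℤ.+ w)
    regroup = ℤ-Ring.solve-∀

  shift-prefix : ∀ j l → prefix (shift a j) l ≡ window (ℤ.- j) l
  shift-prefix j zero    = refl
  shift-prefix j (suc l) =
    trans (cong₂ _+_ (shift-prefix j l) (shift-at j l)) (sym (window-snoc (ℤ.- j) l))

  windows-bounded : ∀ {k l} → (∀ j → Dominated (shift a j) (suc k , l)) →
                    ∀ lo → window lo l ≤ suc k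
  windows-bounded {k} {l} dominated lo =
    subst (_≤ suc k)
          (trans (shift-prefix (ℤ.- lo) l) (window-cong l (ℤₚ.neg-involutive lo)))
          (dominated (ℤ.- lo))

  negSum+prefix : ∀ r p l → r + p ≡ m + l →
                  negSum a r + prefix a p ≡ total a + window (+ p ℤ.- + l) l
  negSum+prefix r p l lengths = begin
    negSum a r + prefix a p
      ≡⟨ cong₂ _+_ (negSum≡window r) (prefix≡window p) ⟩
    window start r + window (+ 0) p
      ≡˘⟨ cong (_+_ (window start r)) (window-cong p (ℤₚ.+-inverseˡ (+ r))) ⟩
    window start r + window (start ℤ.+ + r) p
      ≡˘⟨ window-++ start r p ⟩
    window start (r + p)
      ≡⟨ cong (window start) lengths ⟩
    window start (m + l)
      ≡⟨ window-++ start m l ⟩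
    window start m + window (start ℤ.+ + m) l
      ≡⟨ cong₂ _+_ (window-period start) (window-cong l tail-start) ⟩
    total a + window (+ p ℤ.- + l) l
      ∎
    where
    start = ℤ.- + r
    tail-start : start ℤ.+ + m ≡ + p ℤ.- + l
    tail-start = begin
      start ℤ.+ + m              ≡⟨ ℤₚ.-m+n≡n⊖m r m ⟩
      m ⊖ r                      ≡˘⟨ ℤₚ.+-cancelˡ-⊖ l m r ⟩
      (l + m) ⊖ (l + r)          ≡⟨ cong₂ _⊖_ (trans (+-comm l m) (sym lengths)) (+-comm l r) ⟩
      (r + p) ⊖ (r + l)          ≡⟨ ℤₚ.+-cancelˡ-⊖ r p l ⟩
      p ⊖ l                      ≡˘⟨ ℤₚ.[+m]-[+n]≡m⊖n p l ⟩
      + p ℤ.- + l                ∎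

  search-spec : ∀ i N fuel y₀ → prefix a (pred y₀) ≤ i → y₀ ≤ N → N < y₀ + fuel →
                i < prefix a N →
                let y = search a i fuel y₀ in
                prefix a (pred y) ≤ i × i < prefix a y × y ≤ N
  search-spec i N zero       y₀ _ y₀≤N N<y₀ _ =
    ⊥-elim (<⇒≱ N<y₀ (subst (_≤ N) (sym (+-identityʳ y₀)) y₀≤N))
  search-spec i N (suc fuel) y₀ below y₀≤N N<y₀+fuel i<f[N] with i ℕ.<? f a y₀
  ... | yes i<f[y₀] = below , i<f[y₀] , y₀≤N
  ... | no  i≮f[y₀] =
    search-spec i N fuel (suc y₀) (≮⇒≥ i≮f[y₀]) y₀<N (subst (N <_) (+-suc y₀ fuel) N<y₀+fuel) i<f[N]
    where
    y₀<N : y₀ < N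
    y₀<N with m≤n⇒m<n∨m≡n y₀≤N
    ... | inj₁ y₀<N    = y₀<N
    ... | inj₂ refl    = ⊥-elim (i≮f[y₀] i<f[N])

  yIdx-spec : ∀ i → i < total a →
              Σ ℕ λ y → yIdx a i ≡ suc y × prefix a y ≤ i × i < prefix a (suc y) × y < m
  yIdx-spec i i<total with yIdx a i | search-spec i m (suc m) 0 z≤n z≤n ≤-refl i<total
  ... | zero  | _ , () , _
  ... | suc y | below , above , y<m = y , refl , below , above , y<m

  -- If f(y) ≤ i < f(y+1) with y < m and every window of length l′+1 is at most k+1, then
  -- (i + a_{-1} + … + a_{-r}) mod n ≤ k for r = (m - y) + l′: this is the x-coordinate of b_i^{l′}.
  column-bound : ∀ n .{{_ : NonZero n}} → total a ≡ n → ∀ {k l′ i y} →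
                 (∀ lo → window lo (suc l′) ≤ suc k) → y < m →
                 prefix a y ≤ i → i < prefix a (suc y) →
                 (i + negSum a ((m ∸ y) + l′)) % n ≤ k
  column-bound n total≡n {k} {l′} {i} {y} bounded y<m f[y]≤i i<f[y+1] =
    mod-bound n identity f[y+1]≤W+i i<f[y+1] (bounded lo)
    where
    lo = + suc y ℤ.- + suc l′
    W  = window lo (suc l′)

    lengths : (m ∸ y) + l′ + suc y ≡ m + suc l′
    lengths = trans (swap (m ∸ y) l′ y) (cong (_+ suc l′) (m∸n+n≡m (<⇒≤ y<m)))
      where
      swap : ∀ d x z → (d + x) + suc z ≡ (d + z) + suc x
      swap = ℕ-Ring.solve-∀

    identity : negSum a ((m ∸ y) + l′) + prefix a (suc y) ≡ n + W
    identity = trans (negSum+prefix _ (suc y) (suc l′) lengths) (cong (_+ W) total≡n)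

    last-entry : W ≡ window lo l′ + at a (+ y)
    last-entry = trans (window-snoc lo l′) (cong (λ z → window lo l′ + at a z) (last-index (+ y) (+ l′)))
      where
      last-index : ∀ (z x : ℤ) → ((+ 1 ℤ.+ z) ℤ.- (+ 1 ℤ.+ x)) ℤ.+ x ≡ z
      last-index = ℤ-Ring.solve-∀

    f[y+1]≤W+i : prefix a (suc y) ≤ W + i
    f[y+1]≤W+i = subst (prefix a (suc y) ≤_) (+-comm i W)
                       (ℕₚ.+-mono-≤ f[y]≤i (subst (at a (+ y) ≤_) (sym last-entry) (m≤n+m _ _)))

lemma2 : (m n : ℕ) .{{_ : NonZero m}} .{{_ : NonZero n}} →
         (a : Tuple m) → IsWeakComposition a n →
         (k l : ℕ) → k ≤ n → 1 ≤ l → l ≤ m →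
         (∀ (j : ℤ) → Dominated (shift a j) (suc k , l)) →
         ∀ i → i < n → Complete n a i (k , l)
-- Write l = l′ + 1 (as 1 ≤ l) and y_i = y + 1; the x-coordinate of b_i^{l′} is then
-- (i + a_{-1} + … + a_{-r}) mod n with r = (m - y) + l′, which column-bound controls.
lemma2 m n a total≡n k (suc l′) _ _ _ dominated i i<n
  with yIdx a i | yIdx-spec a i (subst (i <_) (sym total≡n) i<n)
... | _ | y , refl , f[y]≤i , i<f[y+1] , y<m =
  column-bound a n total≡n (windows-bounded a dominated) y<m f[y]≤i i<f[y+1]
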